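{- For every integer $n\geq 2$ with $n\neq 3$ we have $E_{\mathbb Z_n',\{1\}}(n)=n+1$.
   Context: $\mathbb Z_n=\mathbb Z/n\mathbb Z$ as a module over itself and $\mathbb Z_n'=\mathbb Z_n\setminus\{0\}$. A subsequence is a non-empty subfamily of terms in the original order. For non-empty $A,B\subseteq\mathbb Z_n$, a sequence $(x_1,\ldots,x_k)$ is an $(A,B)$-weighted zero-sum sequence if there exist $a_i\in A$, $b_i\in B$ with $\sum a_ix_i=0$ and $\sum b_ia_i=0$. $E_{A,B}(n)$ is the least positive $k$ such that every sequence in $\mathbb Z_n$ of length $k$ has an $(A,B)$-weighted zero-sum subsequence of length $n$. -}

module Defs where

open import Level using (0ℓ)
open import Data.Nat using (ℕ; zero; suc; _+_; _*_; _≤_; _<_)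
open import Data.Nat.Divisibility using (_∣_)
open import Data.Fin using (Fin; toℕ) renaming (zero to fz; suc to fs; _<_ to _<ᶠ_)
open import Data.Product using (Σ; _×_; ∃)
open import Relation.Nullary using (¬_)
open import Relation.Binary.PropositionalEquality using (_≡_)

-- Z_n is represented by Fin n; an element is read as its canonical
-- representative toℕ x ∈ {0,…,n-1}, and "= 0 in Z_n" is "n ∣ value".
ℤ_ : ℕ → Set
ℤ n = Fin n

Σ[<_]_ : (m : ℕ) → (Fin m → ℕ) → ℕ
Σ[< zero ] f = 0
Σ[< suc m ] f = f fz + Σ[< m ] (λ i → f (fs i))

WeightedZeroSum : (n : ℕ) (A B : Fin n → Set) {m : ℕ} → (Fin m → Fin n) → Set
WeightedZeroSum n A B {m} x =
  Σ (Fin m → Fin n) λ a → Σ (Fin m → Fin n) λ b →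
    (∀ i → A (a i)) × (∀ i → B (b i)) ×
    (n ∣ Σ[< m ] (λ i → toℕ (a i) * toℕ (x i))) ×
    (n ∣ Σ[< m ] (λ i → toℕ (b i) * toℕ (a i)))

-- Subsequence of length l of a sequence of length k: strictly increasing
-- index map Fin l → Fin k (terms kept in the original order).
StrictlyIncreasing : {l k : ℕ} → (Fin l → Fin k) → Set
StrictlyIncreasing f = ∀ i j → i <ᶠ j → f i <ᶠ f j

HasEProperty : (n : ℕ) (A B : Fin n → Set) (k : ℕ) → Set
HasEProperty n A B k =
  (x : Fin k → Fin n) →
  Σ (Fin n → Fin k) λ f → StrictlyIncreasing f × WeightedZeroSum n A B (λ i → x (f i))

E-is : (n : ℕ) (A B : Fin n → Set) (e : ℕ) → Set
E-is n A B e =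
  1 ≤ e × HasEProperty n A B e × (∀ k → 1 ≤ k → k < e → ¬ HasEProperty n A B k)

ℤ′ : (n : ℕ) → Fin n → Set
ℤ′ n a = ¬ (toℕ a ≡ 0)

One : (n : ℕ) → Fin n → Set
One n b = toℕ b ≡ 1

-- Lower bound: a sequence shorter than n has no subsequence of length n, and the only
-- subsequence of (1, 0, …, 0) of length n is itself, where Σ aᵢxᵢ = a₁ ≠ 0.
--
-- Upper bound: among n + 1 terms two coincide, x_p = x_q. Since Σ aᵢ = 0, subtracting x_p
-- from every term changes nothing, so we may assume x_p = x_q = 0. For n ≥ 3 a sequence
-- over ℤₙ has nonzero weights with Σ aᵢzᵢ = 0 unless exactly one term is nonzero (pair
-- nonzero terms y, x off with weights x, −y; an odd leftover needs three terms). For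
-- n ≥ 4 one can drop a term other than x_p, x_q so that this exception is avoided, and
-- finally reweight the two zero terms x_p, x_q, using that every element of ℤₙ is a sum
-- of two nonzero ones, to make Σ aᵢ = 0. For n = 2 the two equal terms with weights 1
-- already work.

module Submission where

open import Defs
open import Data.Nat as ℕ using (ℕ; zero; suc; z≤n; s≤s; NonZero)
import Data.Nat.Properties as ℕ
import Data.Nat.Divisibility as ℕ
import Data.Nat.Tactic.RingSolver as NatSolver
open import Data.Fin as Fin using (Fin; toℕ; fromℕ<; punchIn; punchOut) renaming (zero to fz; suc to fs)
import Data.Fin.Properties as Fin
open import Data.Vec.Functional using (Vector; []; _∷_; insertAt; removeAt; updateAt)
open import Data.Vec.Functional.Properties
  using (updateAt-updates; updateAt-minimal; insertAt-lookup; insertAt-punchIn)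
open import Data.Product using (Σ; ∃; ∃₂; _×_; _,_; proj₁; proj₂)
open import Data.Sum as Sum using (_⊎_; inj₁; inj₂)
open import Function using (_∘_; const)
open import Relation.Nullary using (¬_; yes; no; contradiction)
open import Relation.Nullary.Decidable using (¬?; _×-dec_; decidable-stable)
open import Relation.Binary.PropositionalEquality

private
  variable
    k l m n : ℕ

∃-uncovered : (xs : Vector (Fin m) l) → l ℕ.< m → ∃ λ k → ∀ i → xs i ≢ k
∃-uncovered {m} {l} xs l<m with Fin.any? (λ k → Fin.all? (λ i → ¬? (xs i Fin.≟ k)))
... | yes uncovered = uncovered
... | no all-covered = contradiction (Fin.pigeonhole l<m (proj₁ ∘ covered)) no-repeats
  where
  covered : ∀ k → ∃ λ i → xs i ≡ k
  covered k with Fin.¬∀⟶∃¬ l _ (λ i → ¬? (xs i Fin.≟ k)) (λ k∉xs → all-covered (k , k∉xs))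
  ... | i , ¬xsᵢ≢k = i , decidable-stable (xs i Fin.≟ k) ¬xsᵢ≢k

  no-repeats : ¬ ∃₂ λ k₁ k₂ → k₁ Fin.< k₂ × proj₁ (covered k₁) ≡ proj₁ (covered k₂)
  no-repeats (k₁ , k₂ , k₁<k₂ , same) =
    Fin.<⇒≢ k₁<k₂ (trans (sym (proj₂ (covered k₁))) (trans (cong xs same) (proj₂ (covered k₂))))

punchIn-strictlyIncreasing : (j : Fin (suc m)) → StrictlyIncreasing (punchIn j)
punchIn-strictlyIncreasing j i k i<k =
  Fin.≤∧≢⇒< (Fin.punchIn-mono-≤ j i k (ℕ.<⇒≤ i<k)) (Fin.<⇒≢ i<k ∘ Fin.punchIn-injective j i k)

updateAt-cases : {A : Set} (t : Vector A m) (i : Fin m) (f : A → A) (j : Fin m) →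
                 (j ≡ i × updateAt t i f j ≡ f (t i)) ⊎ updateAt t i f j ≡ t j
updateAt-cases t i f j with j Fin.≟ i
... | yes refl = inj₁ (refl , updateAt-updates i t)
... | no j≢i   = inj₂ (updateAt-minimal j i t j≢i)

module IntegerWeights where

  open import Data.Integer as ℤ using (ℤ; +_; 0ℤ; _+_; _*_; -_; _-_)
  import Data.Integer.Properties as ℤ
  open import Data.Integer.Divisibility.Signed
  open import Data.Integer.DivMod using (_%ℕ_; _/ℕ_; n%ℕd<d; a≡a%ℕn+[a/ℕn]*n)
  open import Data.Integer.Tactic.RingSolver using (solve-∀)
  open import Algebra.Properties.Semiring.Sum ℤ.+-*-semiring
    using (sum; sum-remove; ∑-distrib-+; *-distribˡ-sum; sum-cong-≗)

  sum-updateAt : (t : Vector ℤ m) (i : Fin m) (f : ℤ → ℤ) →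
                 sum (updateAt t i f) ≡ sum t + (f (t i) - t i)
  sum-updateAt {suc m} t i f = begin
    sum (updateAt t i f)                          ≡⟨ sum-remove {i = i} (updateAt t i f) ⟩
    updateAt t i f i + sum (removeAt (updateAt t i f) i)
      ≡⟨ cong₂ _+_ (updateAt-updates i t) (sum-cong-≗ (λ k → updateAt-minimal _ i t (Fin.punchInᵢ≢i i k))) ⟩
    f (t i) + sum (removeAt t i)                  ≡⟨ rearrange (f (t i)) (t i) (sum (removeAt t i)) ⟩
    t i + sum (removeAt t i) + (f (t i) - t i)    ≡⟨ cong (_+ (f (t i) - t i)) (sum-remove {i = i} t) ⟨
    sum t + (f (t i) - t i)                       ∎
    where
    open ≡-Reasoning
    rearrange : ∀ x y s → x + s ≡ y + s + (x - y)
    rearrange = solve-∀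

  erase : Fin m → Vector ℤ m → Vector ℤ m
  erase j z = updateAt z j (const 0ℤ)

  +-Σ : (f : Fin m → ℕ) → + (Σ[< m ] f) ≡ sum (λ i → + f i)
  +-Σ {zero}  f = refl
  +-Σ {suc m} f = trans (ℤ.pos-+ (f fz) _) (cong (λ s → + f fz + s) (+-Σ (f ∘ fs)))

  infix 4 _∤_
  _∤_ : ℤ → ℤ → Set
  k ∤ a = ¬ k ∣ a

  module Modulo (n : ℕ) where

    ∣0 : + n ∣ 0ℤ
    ∣0 = divides 0ℤ refl

    small∤ : suc k ℕ.< n → + n ∤ + suc k
    small∤ k<n = ℕ.>⇒∤ k<n ∘ ∣⇒∣ᵤ

    neg∤ : ∀ {a} → + n ∤ a → + n ∤ - a
    neg∤ {a} n∤a n∣-a = n∤a (subst (+ n ∣_) (ℤ.neg-involutive a) (∣m⇒∣-m n∣-a))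

    ∣-by : ∀ {e} c {d} → e ≡ c * d → + n ∣ d → + n ∣ e
    ∣-by c e≡cd n∣d = subst (+ n ∣_) (sym e≡cd) (∣n⇒∣m*n c n∣d)

    ∣-sum : (f : Vector ℤ m) → (∀ i → + n ∣ f i) → + n ∣ sum f
    ∣-sum {zero}  f n∣f = ∣0
    ∣-sum {suc m} f n∣f = ∣m∣n⇒∣m+n (n∣f fz) (∣-sum (f ∘ fs) (n∣f ∘ fs))

    ∣-sum-cong : (f g : Vector ℤ m) → (∀ i → + n ∣ f i - g i) → + n ∣ sum g → + n ∣ sum f
    ∣-sum-cong f g n∣f-g n∣Σg = subst (+ n ∣_) Σf-g+Σg≡Σf (∣m∣n⇒∣m+n (∣-sum _ n∣f-g) n∣Σg)
      where
      Σf-g+Σg≡Σf : sum (λ i → f i - g i) + sum g ≡ sum f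
      Σf-g+Σg≡Σf = trans (sym (∑-distrib-+ (λ i → f i - g i) g))
                         (sum-cong-≗ (λ i → a-b+b≡a (f i) (g i)))
        where
        a-b+b≡a : ∀ a b → a - b + b ≡ a
        a-b+b≡a = solve-∀

    Nonzero : Vector ℤ m → Set
    Nonzero W = ∀ i → + n ∤ W i

    AllZero : Vector ℤ m → Set
    AllZero z = ∀ i → + n ∣ z i

    OnlyNonzeroAt : Vector ℤ m → Fin m → Set
    OnlyNonzeroAt z i = + n ∤ z i × (∀ k → k ≢ i → + n ∣ z k)

    infix 7 _·_
    _·_ : Vector ℤ m → Vector ℤ m → ℤ
    W · z = sum (λ i → W i * z i)

    ZeroSumWeights : Vector ℤ m → Set
    ZeroSumWeights {m} z = Σ (Vector ℤ m) λ W → Nonzero W × + n ∣ W · z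

    -- The integer form of a (ℤₙ′, {1})-weighted zero-sum sequence.
    BalancedZeroSumWeights : Vector ℤ m → Set
    BalancedZeroSumWeights {m} z = Σ (Vector ℤ m) λ W → Nonzero W × + n ∣ sum W × + n ∣ W · z

    Nonzero-∷ : ∀ {a} {W : Vector ℤ m} → + n ∤ a → Nonzero W → Nonzero (a ∷ W)
    Nonzero-∷ n∤a n∤W fz     = n∤a
    Nonzero-∷ n∤a n∤W (fs i) = n∤W i

    Nonzero-insertAt : ∀ {a} (W : Vector ℤ m) i → + n ∤ a → Nonzero W → Nonzero (insertAt W i a)
    Nonzero-insertAt {m}     W fz     n∤a n∤W fz     = n∤a
    Nonzero-insertAt {m}     W fz     n∤a n∤W (fs j) = n∤W j
    Nonzero-insertAt {suc m} W (fs i) n∤a n∤W fz     = n∤W fz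
    Nonzero-insertAt {suc m} W (fs i) n∤a n∤W (fs j) = Nonzero-insertAt (W ∘ fs) i n∤a (n∤W ∘ fs) j

    zeroSum-≗ : {z z′ : Vector ℤ m} → (∀ i → z i ≡ z′ i) → ZeroSumWeights z → ZeroSumWeights z′
    zeroSum-≗ z≗z′ (W , n∤W , n∣W·z) =
      W , n∤W , subst (+ n ∣_) (sum-cong-≗ (λ i → cong (W i *_) (z≗z′ i))) n∣W·z

    zeroSum-removeAt : (z : Vector ℤ (suc m)) (j : Fin (suc m)) → + n ∣ z j →
                       ZeroSumWeights z → ZeroSumWeights (removeAt z j)
    zeroSum-removeAt z j n∣zⱼ (W , n∤W , n∣W·z) =
      removeAt W j , n∤W ∘ punchIn j ,
      ∣m+n∣m⇒∣n (subst (+ n ∣_) (sum-remove {i = j} (λ i → W i * z i)) n∣W·z) (∣n⇒∣m*n (W j) n∣zⱼ)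

    zeroSum-erase⇒removeAt : (z : Vector ℤ (suc m)) (j : Fin (suc m)) →
                             ZeroSumWeights (erase j z) → ZeroSumWeights (removeAt z j)
    zeroSum-erase⇒removeAt z j =
      zeroSum-≗ (λ i → updateAt-minimal _ j z (Fin.punchInᵢ≢i j i)) ∘
      zeroSum-removeAt (erase j z) j (subst (+ n ∣_) (sym (updateAt-updates j z)) ∣0)

    zeroSum-insertAt : (z : Vector ℤ m) (j : Fin (suc m)) {v : ℤ} → + n ∣ v → + n ∤ + 1 →
                       ZeroSumWeights z → ZeroSumWeights (insertAt z j v)
    zeroSum-insertAt z j {v} n∣v n∤1 (W , n∤W , n∣W·z) =
      W′ , Nonzero-insertAt W j n∤1 n∤W ,
      subst (+ n ∣_) (sym W′·z′≡v+W·z) (∣m∣n⇒∣m+n (∣n⇒∣m*n (+ 1) n∣v) n∣W·z)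
      where
      W′ = insertAt W j (+ 1)
      z′ = insertAt z j v
      W′·z′≡v+W·z : W′ · z′ ≡ + 1 * v + W · z
      W′·z′≡v+W·z = trans (sum-remove {i = j} (λ i → W′ i * z′ i))
        (cong₂ _+_ (cong₂ _*_ (insertAt-lookup W j _) (insertAt-lookup z j v))
                   (sum-cong-≗ λ i → cong₂ _*_ (insertAt-punchIn W j _ i) (insertAt-punchIn z j v i)))

    zeroSum-updateAt : (z W : Vector ℤ m) (i : Fin m) {c : ℤ} → + n ∣ z i → + n ∤ c →
                       Nonzero W → + n ∣ W · z →
                       Nonzero (updateAt W i (const c)) × + n ∣ updateAt W i (const c) · z
    zeroSum-updateAt z W i {c} n∣zᵢ n∤c n∤W n∣W·z = n∤W′ , ∣-sum-cong _ _ W′z≡Wz n∣W·z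
      where
      W′ = updateAt W i (const c)

      n∤W′ : Nonzero W′
      n∤W′ j with updateAt-cases W i (const c) j
      ... | inj₁ (_ , W′ⱼ≡c) = subst (+ n ∤_) (sym W′ⱼ≡c) n∤c
      ... | inj₂ W′ⱼ≡Wⱼ       = subst (+ n ∤_) (sym W′ⱼ≡Wⱼ) (n∤W j)

      W′z≡Wz : ∀ j → + n ∣ W′ j * z j - W j * z j
      W′z≡Wz j with updateAt-cases W i (const c) j
      ... | inj₁ (refl , _) = ∣-by (W′ j - W j) (factor (W′ j) (W j) (z j)) n∣zᵢ
        where
        factor : ∀ a b x → a * x - b * x ≡ (a - b) * x
        factor = solve-∀
      ... | inj₂ W′ⱼ≡Wⱼ rewrite W′ⱼ≡Wⱼ = subst (+ n ∣_) (sym (ℤ.+-inverseʳ (W j * z j))) ∣0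

    balanced-shift : (v : Vector ℤ m) (c : ℤ) →
                     BalancedZeroSumWeights (λ i → v i - c) → BalancedZeroSumWeights v
    balanced-shift v c (F , n∤F , n∣ΣF , n∣F·v-c) =
      F , n∤F , n∣ΣF , subst (+ n ∣_) (sym F·v≡) (∣m∣n⇒∣m+n n∣F·v-c (∣n⇒∣m*n c n∣ΣF))
      where
      open ≡-Reasoning
      shift : ∀ f x c → f * x ≡ f * (x - c) + c * f
      shift = solve-∀
      F·v≡ : F · v ≡ F · (λ i → v i - c) + c * sum F
      F·v≡ = begin
        F · v                                      ≡⟨ sum-cong-≗ (λ i → shift (F i) (v i) c) ⟩
        sum (λ i → F i * (v i - c) + c * F i)      ≡⟨ ∑-distrib-+ (λ i → F i * (v i - c)) (λ i → c * F i) ⟩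
        F · (λ i → v i - c) + sum (λ i → c * F i)  ≡⟨ cong (λ t → F · (λ i → v i - c) + t) (*-distribˡ-sum c F) ⟨
        F · (λ i → v i - c) + c * sum F            ∎

    zeroSum-[] : ZeroSumWeights []
    zeroSum-[] = [] , (λ ()) , ∣0

    zeroSum-prepend-∷∷ : ∀ {y x} {z : Vector ℤ m} → + n ∤ y → + n ∤ x →
                     ZeroSumWeights z → ZeroSumWeights (y ∷ x ∷ z)
    zeroSum-prepend-∷∷ {y = y} {x} {z} n∤y n∤x (W , n∤W , n∣W·z) =
      x ∷ - y ∷ W , Nonzero-∷ n∤x (Nonzero-∷ (neg∤ n∤y) n∤W) ,
      subst (+ n ∣_) (sym (cancel x y (W · z))) n∣W·z
      where
      cancel : ∀ x y s → x * y + (- y * x + s) ≡ s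
      cancel = solve-∀

    module _ (3≤n : 3 ℕ.≤ n) where

      1∤ : + n ∤ + 1
      1∤ = small∤ (ℕ.≤-trans (ℕ.n≤1+n 2) 3≤n)

      2∤ : + n ∤ + 2
      2∤ = small∤ 3≤n

      split-nonzero : (s : ℤ) → ∃₂ λ a b → + n ∤ a × + n ∤ b × a + b ≡ s
      split-nonzero s with + n ∣? s - + 1
      ... | yes n∣s-1 = + 2 , s - + 2 , 2∤ , n∤s-2 , 2+[s-2]≡s s
        where
        2+[s-2]≡s : ∀ s → + 2 + (s - + 2) ≡ s
        2+[s-2]≡s = solve-∀
        [s-1]-[s-2]≡1 : ∀ s → s - + 1 - (s - + 2) ≡ + 1
        [s-1]-[s-2]≡1 = solve-∀
        n∤s-2 : + n ∤ s - + 2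
        n∤s-2 n∣s-2 = 1∤ (subst (+ n ∣_) ([s-1]-[s-2]≡1 s) (∣m∣n⇒∣m-n n∣s-1 n∣s-2))
      ... | no n∤s-1 = + 1 , s - + 1 , 1∤ , n∤s-1 , 1+[s-1]≡s s
        where
        1+[s-1]≡s : ∀ s → + 1 + (s - + 1) ≡ s
        1+[s-1]≡s = solve-∀

      allZero⇒zeroSum : {z : Vector ℤ m} → AllZero z → ZeroSumWeights z
      allZero⇒zeroSum z≡0 = (λ _ → + 1) , (λ _ → 1∤) , ∣-sum _ (λ i → ∣n⇒∣m*n (+ 1) (z≡0 i))

      zeroSum-∷∷∷-with : ∀ {y x u a b c} {z : Vector ℤ m} → + n ∤ a → + n ∤ b → + n ∤ c →
                         + n ∣ a * y + b * x + c * u → AllZero z → ZeroSumWeights (y ∷ x ∷ u ∷ z)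
      zeroSum-∷∷∷-with {y = y} {x} {u} {a} {b} {c} {z} n∤a n∤b n∤c n∣ay+bx+cu z≡0 with allZero⇒zeroSum z≡0
      ... | W , n∤W , n∣W·z =
        a ∷ b ∷ c ∷ W , Nonzero-∷ n∤a (Nonzero-∷ n∤b (Nonzero-∷ n∤c n∤W)) ,
        subst (+ n ∣_) (reassociate a y b x c u (W · z)) (∣m∣n⇒∣m+n n∣ay+bx+cu n∣W·z)
        where
        reassociate : ∀ a y b x c u s → a * y + b * x + c * u + s ≡ a * y + (b * x + (c * u + s))
        reassociate = solve-∀

      -- Either two of y, x, u are congruent, whose weights are then chosen to cancel
      -- against the third, or (u − x, y − u, x − y) are nonzero weights.
      zeroSum-∷∷∷ : ∀ {y x u} {z : Vector ℤ m} → + n ∤ y → + n ∤ x → + n ∤ u →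
                      AllZero z → ZeroSumWeights (y ∷ x ∷ u ∷ z)
      zeroSum-∷∷∷ {y = y} {x} {u} n∤y n∤x n∤u z≡0 with + n ∣? x - y | + n ∣? u - x | + n ∣? y - u
      ... | yes n∣x-y | _ | _ with split-nonzero u
      ...   | a , b , n∤a , n∤b , refl = zeroSum-∷∷∷-with n∤a n∤b (neg∤ n∤y) (∣-by b (identity a b y x) n∣x-y) z≡0
        where
        identity : ∀ a b y x → a * y + b * x + - y * (a + b) ≡ b * (x - y)
        identity = solve-∀
      zeroSum-∷∷∷ {y = y} {x} {u} n∤y n∤x n∤u z≡0 | no _ | yes n∣u-x | _ with split-nonzero y
      ...   | b , c , n∤b , n∤c , refl = zeroSum-∷∷∷-with (neg∤ n∤x) n∤b n∤c (∣-by c (identity b c x u) n∣u-x) z≡0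
        where
        identity : ∀ b c x u → - x * (b + c) + b * x + c * u ≡ c * (u - x)
        identity = solve-∀
      zeroSum-∷∷∷ {y = y} {x} {u} n∤y n∤x n∤u z≡0 | no _ | no _ | yes n∣y-u with split-nonzero x
      ...   | a , c , n∤a , n∤c , refl = zeroSum-∷∷∷-with n∤a (neg∤ n∤u) n∤c (∣-by a (identity a c y u) n∣y-u) z≡0
        where
        identity : ∀ a c y u → a * y + - u * (a + c) + c * u ≡ a * (y - u)
        identity = solve-∀
      zeroSum-∷∷∷ {y = y} {x} {u} n∤y n∤x n∤u z≡0 | no n∤x-y | no n∤u-x | no n∤y-u =
        zeroSum-∷∷∷-with n∤u-x n∤y-u n∤x-y (subst (+ n ∣_) (sym (identity x y u)) ∣0) z≡0
        where
        identity : ∀ x y u → (u - x) * y + (y - u) * x + (x - y) * u ≡ 0ℤ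
        identity = solve-∀

      -- Scanning from the left, at most two nonzero entries are kept pending: a pending pair
      -- y, x is closed off by the weights x, −y, and three pending entries facing an
      -- all-zero tail by zeroSum-∷∷∷.
      zeroSum-or-onlyNonzero : (z : Vector ℤ m) → ZeroSumWeights z ⊎ ∃ (OnlyNonzeroAt z)
      zeroSum-∷-or-allZero : ∀ {y} → + n ∤ y → (z : Vector ℤ m) → ZeroSumWeights (y ∷ z) ⊎ AllZero z
      zeroSum-∷∷ : ∀ {y x} → + n ∤ y → + n ∤ x → (z : Vector ℤ m) → ZeroSumWeights (y ∷ x ∷ z)

      zeroSum-or-onlyNonzero {zero} z = inj₁ zeroSum-[]
      zeroSum-or-onlyNonzero {suc m} z with + n ∣? z fz
      ... | yes n∣z₀ =
        Sum.map (zeroSum-insertAt (z ∘ fs) fz n∣z₀ 1∤) shift (zeroSum-or-onlyNonzero (z ∘ fs))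
        where
        shift : ∃ (OnlyNonzeroAt (z ∘ fs)) → ∃ (OnlyNonzeroAt z)
        shift (i , n∤zᵢ , rest≡0) = fs i , n∤zᵢ , λ { fz _ → n∣z₀ ; (fs k) k≢i → rest≡0 k (k≢i ∘ cong fs) }
      ... | no n∤z₀ =
        Sum.map₂ (λ rest≡0 → fz , n∤z₀ , λ { fz 0≢0 → contradiction refl 0≢0 ; (fs k) _ → rest≡0 k })
                 (zeroSum-∷-or-allZero n∤z₀ (z ∘ fs))

      zeroSum-∷-or-allZero {zero} n∤y z = inj₂ (λ ())
      zeroSum-∷-or-allZero {suc m} {y} n∤y z with + n ∣? z fz
      ... | yes n∣z₀ =
        Sum.map (zeroSum-insertAt (y ∷ z ∘ fs) (fs fz) n∣z₀ 1∤) (λ rest≡0 → λ { fz → n∣z₀ ; (fs k) → rest≡0 k })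
                (zeroSum-∷-or-allZero n∤y (z ∘ fs))
      ... | no n∤z₀ = inj₁ (zeroSum-∷∷ n∤y n∤z₀ (z ∘ fs))

      zeroSum-∷∷ {zero} n∤y n∤x z = zeroSum-prepend-∷∷ {z = z} n∤y n∤x zeroSum-[]
      zeroSum-∷∷ {suc m} {y} {x} n∤y n∤x z with + n ∣? z fz
      ... | yes n∣z₀ = zeroSum-insertAt (y ∷ x ∷ z ∘ fs) (fs (fs fz)) n∣z₀ 1∤ (zeroSum-∷∷ n∤y n∤x (z ∘ fs))
      ... | no n∤z₀ with zeroSum-∷-or-allZero n∤z₀ (z ∘ fs)
      ...   | inj₁ zeroSum-rest = zeroSum-prepend-∷∷ {z = z} n∤y n∤x zeroSum-rest
      ...   | inj₂ rest≡0       = zeroSum-∷∷∷ {z = z ∘ fs} n∤y n∤x n∤z₀ rest≡0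

      rebalance : (z : Vector ℤ m) {p q : Fin m} → p ≢ q → + n ∣ z p → + n ∣ z q →
                  ZeroSumWeights z → BalancedZeroSumWeights z
      rebalance z {p} {q} p≢q n∣zp n∣zq (W , n∤W , n∣W·z) with split-nonzero (- (sum W - W p - W q))
      ... | a , b , n∤a , n∤b , a+b≡ = F , n∤F , subst (+ n ∣_) (sym ΣF≡0) ∣0 , n∣F·z
        where
        W₁ = updateAt W p (const a)
        F  = updateAt W₁ q (const b)

        W₁-ok : Nonzero W₁ × + n ∣ W₁ · z
        W₁-ok = zeroSum-updateAt z W p n∣zp n∤a n∤W n∣W·z

        F-ok : Nonzero F × + n ∣ F · z
        F-ok = zeroSum-updateAt z W₁ q n∣zq n∤b (proj₁ W₁-ok) (proj₂ W₁-ok)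

        n∤F   = proj₁ F-ok
        n∣F·z = proj₂ F-ok

        regroup : ∀ s x y a b → s + (a - x) + (b - y) ≡ s - x - y + (a + b)
        regroup = solve-∀

        open ≡-Reasoning
        ΣF≡0 : sum F ≡ 0ℤ
        ΣF≡0 = begin
          sum F                                     ≡⟨ sum-updateAt W₁ q _ ⟩
          sum W₁ + (b - W₁ q)
            ≡⟨ cong₂ (λ s w → s + (b - w)) (sum-updateAt W p _) (updateAt-minimal q p W (p≢q ∘ sym)) ⟩
          sum W + (a - W p) + (b - W q)             ≡⟨ regroup (sum W) (W p) (W q) a b ⟩
          sum W - W p - W q + (a + b)               ≡⟨ cong (λ t → sum W - W p - W q + t) a+b≡ ⟩
          sum W - W p - W q + - (sum W - W p - W q) ≡⟨ ℤ.+-inverseʳ (sum W - W p - W q) ⟩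
          0ℤ                                        ∎

      omit-beside-zero : (z : Vector ℤ (suc m)) {p q k : Fin (suc m)} → k ≢ p → k ≢ q → + n ∣ z k →
                         + n ∣ z p → + n ∣ z q → ∃ λ j → j ≢ p × j ≢ q × ZeroSumWeights (removeAt z j)
      omit-beside-zero z {p} {q} {k} k≢p k≢q n∣zk n∣zp n∣zq with zeroSum-or-onlyNonzero (erase k z)
      ... | inj₁ zeroSum = k , k≢p , k≢q , zeroSum-erase⇒removeAt z k zeroSum
      ... | inj₂ (i , n∤zᵢ , rest≡0) =
        i , i≢ (k≢p ∘ sym) n∣zp , i≢ (k≢q ∘ sym) n∣zq , zeroSum-erase⇒removeAt z i (allZero⇒zeroSum erased≡0)
        where
        i≢ : ∀ {t} → t ≢ k → + n ∣ z t → i ≢ t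
        i≢ t≢k n∣zt refl = n∤zᵢ (subst (+ n ∣_) (sym (updateAt-minimal _ k z t≢k)) n∣zt)

        erased≡0 : AllZero (erase i z)
        erased≡0 t with t Fin.≟ i | t Fin.≟ k
        ... | yes refl | _        = subst (+ n ∣_) (sym (updateAt-updates i z)) ∣0
        ... | no t≢i   | yes refl = subst (+ n ∣_) (sym (updateAt-minimal t i z t≢i)) n∣zk
        ... | no t≢i   | no t≢k   =
          subst (+ n ∣_) (trans (updateAt-minimal t k z t≢k) (sym (updateAt-minimal t i z t≢i))) (rest≡0 t t≢i)

      -- If a term outside {p, q} vanishes, omit-beside-zero drops it, or drops the single
      -- nonzero term left after erasing it; otherwise all terms outside {p, q} are nonzero,
      -- and dropping any one of them leaves at least two.
      omit-index : 4 ℕ.≤ n → (z : Vector ℤ (suc n)) {p q : Fin (suc n)} → p ≢ q → + n ∣ z p → + n ∣ z q →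
                   ∃ λ j → j ≢ p × j ≢ q × ZeroSumWeights (removeAt z j)
      omit-index 4≤n z {p} {q} p≢q n∣zp n∣zq
        with Fin.any? (λ k → (¬? (k Fin.≟ p) ×-dec ¬? (k Fin.≟ q)) ×-dec (+ n ∣? z k))
      ... | yes (k , (k≢p , k≢q) , n∣zk) = omit-beside-zero z k≢p k≢q n∣zk n∣zp n∣zq
      ... | no no-further-zero with ∃-uncovered (p ∷ q ∷ []) (s≤s (ℕ.≤-trans (ℕ.n≤1+n 2) 3≤n))
      ...   | j , j∉pq with zeroSum-or-onlyNonzero (erase j z)
      ...     | inj₁ zeroSum = j , j∉pq fz ∘ sym , j∉pq (fs fz) ∘ sym , zeroSum-erase⇒removeAt z j zeroSum
      ...     | inj₂ (i , _ , rest≡0) with ∃-uncovered (p ∷ q ∷ j ∷ i ∷ []) (s≤s 4≤n)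
      ...       | k , k∉pqji = contradiction (k , (k∉pqji fz ∘ sym , k∉pqji (fs fz) ∘ sym) , n∣zk) no-further-zero
        where
        n∣zk : + n ∣ z k
        n∣zk = subst (+ n ∣_) (updateAt-minimal k j z (k∉pqji (fs (fs fz)) ∘ sym))
                              (rest≡0 k (k∉pqji (fs (fs (fs fz))) ∘ sym))

      balanced-omitting-one : 4 ℕ.≤ n → (v : Vector ℤ (suc n)) {p q : Fin (suc n)} → p ≢ q → v p ≡ v q →
                              ∃ λ j → BalancedZeroSumWeights (removeAt v j)
      balanced-omitting-one 4≤n v {p} {q} p≢q vp≡vq =
        let j , j≢p , j≢q , zeroSum = omit-index 4≤n z p≢q n∣zp n∣zq
        in j , balanced-shift (removeAt v j) (v p)
                 (rebalance (removeAt z j) (p≢q ∘ Fin.punchOut-injective j≢p j≢q)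
                            (subst (λ t → + n ∣ z t) (sym (Fin.punchIn-punchOut j≢p)) n∣zp)
                            (subst (λ t → + n ∣ z t) (sym (Fin.punchIn-punchOut j≢q)) n∣zq)
                            zeroSum)
        where
        z : Vector ℤ (suc n)
        z i = v i - v p

        n∣zp : + n ∣ z p
        n∣zp = subst (+ n ∣_) (sym (ℤ.+-inverseʳ (v p))) ∣0

        n∣zq : + n ∣ z q
        n∣zq = subst (λ t → + n ∣ t - v p) vp≡vq n∣zp

    module _ .{{_ : NonZero n}} where

      residue : ℤ → Fin n
      residue a = fromℕ< (n%ℕd<d a n)

      residue-≡ : ∀ a → + n ∣ + toℕ (residue a) - a
      residue-≡ a = divides (- (a /ℕ n)) (begin
        + toℕ (residue a) - a
          ≡⟨ cong₂ _-_ (cong +_ (Fin.toℕ-fromℕ< (n%ℕd<d a n))) (a≡a%ℕn+[a/ℕn]*n a n) ⟩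
        + (a %ℕ n) - (+ (a %ℕ n) + a /ℕ n * + n) ≡⟨ cancel (+ (a %ℕ n)) (a /ℕ n) (+ n) ⟩
        - (a /ℕ n) * + n                          ∎)
        where
        open ≡-Reasoning
        cancel : ∀ r q d → r - (r + q * d) ≡ - q * d
        cancel = solve-∀

      ∣-Σ : (f : Fin m → ℕ) → + n ∣ sum (λ i → + f i) → n ℕ.∣ Σ[< m ] f
      ∣-Σ f = ∣⇒∣ᵤ ∘ subst (+ n ∣_) (sym (+-Σ f))

      balanced⇒weightedZeroSum : 1 ℕ.< n → (x : Vector (Fin n) m) →
                                 BalancedZeroSumWeights (λ i → + toℕ (x i)) → WeightedZeroSum n (ℤ′ n) (One n) x
      balanced⇒weightedZeroSum 1<n x (F , n∤F , n∣ΣF , n∣F·x) =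
        a , (λ _ → one) , a≢0 , (λ _ → Fin.toℕ-fromℕ< 1<n) ,
        ∣-Σ (λ i → toℕ (a i) ℕ.* toℕ (x i)) (∣-sum-cong _ _ ax≡Fx n∣F·x) ,
        ∣-Σ (λ i → toℕ one ℕ.* toℕ (a i)) (∣-sum-cong _ _ 1a≡F n∣ΣF)
        where
        a : Vector (Fin n) _
        a = residue ∘ F

        one : Fin n
        one = fromℕ< 1<n

        a≢0 : ∀ i → ℤ′ n (a i)
        a≢0 i aᵢ≡0 = n∤F i (subst (+ n ∣_) (r-[r-f]≡f (+ 0) (F i))
                                  (∣m∣n⇒∣m-n ∣0 (subst (λ r → + n ∣ + r - F i) aᵢ≡0 (residue-≡ (F i)))))
          where
          r-[r-f]≡f : ∀ r f → r - (r - f) ≡ f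
          r-[r-f]≡f = solve-∀

        ax≡Fx : ∀ i → + n ∣ + (toℕ (a i) ℕ.* toℕ (x i)) - F i * + toℕ (x i)
        ax≡Fx i = ∣-by (+ toℕ (x i)) (trans (cong (_- F i * + toℕ (x i)) (ℤ.pos-* (toℕ (a i)) (toℕ (x i))))
                                            (factor (+ toℕ (a i)) (F i) (+ toℕ (x i))))
                       (residue-≡ (F i))
          where
          factor : ∀ r f t → r * t - f * t ≡ t * (r - f)
          factor = solve-∀

        1a≡F : ∀ i → + n ∣ + (toℕ one ℕ.* toℕ (a i)) - F i
        1a≡F i = subst (λ t → + n ∣ + t - F i)
                       (sym (trans (cong (ℕ._* toℕ (a i)) (Fin.toℕ-fromℕ< 1<n)) (ℕ.*-identityˡ (toℕ (a i)))))
                       (residue-≡ (F i))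

  upper-bound : 4 ℕ.≤ n → HasEProperty n (ℤ′ n) (One n) (suc n)
  upper-bound {n} 4≤n x =
    let p , q , p<q , xp≡xq = Fin.pigeonhole (ℕ.n<1+n n) x
        j , balanced = balanced-omitting-one 3≤n 4≤n (λ i → + toℕ (x i)) (Fin.<⇒≢ p<q) (cong (λ y → + toℕ y) xp≡xq)
    in punchIn j , punchIn-strictlyIncreasing j , balanced⇒weightedZeroSum 1<n (x ∘ punchIn j) balanced
    where
    open Modulo n
    3≤n : 3 ℕ.≤ n
    3≤n = ℕ.≤-trans (ℕ.n≤1+n 3) 4≤n
    1<n : 1 ℕ.< n
    1<n = ℕ.≤-trans (ℕ.n≤1+n 2) 3≤n
    instance
      _ : NonZero n
      _ = ℕ.>-nonZero (ℕ.<-trans (s≤s z≤n) 1<n)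

open IntegerWeights using (upper-bound)
open import Data.Nat using (_≤_; _<_; _+_; _*_)

pair-strictlyIncreasing : {p q : Fin m} → p Fin.< q → StrictlyIncreasing (p ∷ q ∷ [])
pair-strictlyIncreasing p<q fz      (fs fz) _         = p<q
pair-strictlyIncreasing p<q fz      fz      ()
pair-strictlyIncreasing p<q (fs fz) fz      ()
pair-strictlyIncreasing p<q (fs fz) (fs fz) (s≤s ())

upper-bound-2 : HasEProperty 2 (ℤ′ 2) (One 2) 3
upper-bound-2 x with Fin.pigeonhole (ℕ.n<1+n 2) x
... | p , q , p<q , xp≡xq =
  p ∷ q ∷ [] , pair-strictlyIncreasing p<q , (λ _ → fs fz) , (λ _ → fs fz) , (λ _ ()) , (λ _ → refl) ,
  subst (λ y → 2 ℕ.∣ 1 * toℕ y + (1 * toℕ (x q) + 0)) (sym xp≡xq) (ℕ.divides (toℕ (x q)) (double (toℕ (x q)))) ,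
  ℕ.divides 1 refl
  where
  double : ∀ t → 1 * t + (1 * t + 0) ≡ t * 2
  double = NatSolver.solve-∀

no-shorter-sequence : {A B : Fin n → Set} → k < n → ¬ HasEProperty n A B k
no-shorter-sequence {suc n} k<n has with has (λ _ → fz)
... | f , f↑ , _ with Fin.pigeonhole k<n f
...   | i , j , i<j , fᵢ≡fⱼ = Fin.<⇒≢ (f↑ i j i<j) fᵢ≡fⱼ

strictlyIncreasing-suc≢fz : {f : Fin (suc m) → Fin (suc l)} → StrictlyIncreasing f → ∀ i → f (fs i) ≢ fz
strictlyIncreasing-suc≢fz {f = f} f↑ i fᵢ₊₁≡0 =
  ℕ.n≮0 (subst (λ t → f fz Fin.< t) fᵢ₊₁≡0 (f↑ fz (fs i) (s≤s z≤n)))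

strictlyIncreasing-fz : (f : Fin (suc m) → Fin (suc m)) → StrictlyIncreasing f → f fz ≡ fz
strictlyIncreasing-fz {m} f f↑ with f fz Fin.≟ fz
... | yes f₀≡0 = f₀≡0
... | no f₀≢0  = contradiction (Fin.pigeonhole (ℕ.n<1+n m) (λ i → punchOut (0≢f i))) no-collision
  where
  0≢f : ∀ i → fz ≢ f i
  0≢f fz     = f₀≢0 ∘ sym
  0≢f (fs i) = strictlyIncreasing-suc≢fz f↑ i ∘ sym

  no-collision : ¬ ∃₂ λ i j → i Fin.< j × punchOut (0≢f i) ≡ punchOut (0≢f j)
  no-collision (i , j , i<j , same) = Fin.<⇒≢ (f↑ i j i<j) (Fin.punchOut-injective (0≢f i) (0≢f j) same)

Σ-zero : (f : Fin m → ℕ) → (∀ i → f i ≡ 0) → Σ[< m ] f ≡ 0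
Σ-zero {zero}  f f≡0 = refl
Σ-zero {suc m} f f≡0 = cong₂ _+_ (f≡0 fz) (Σ-zero (f ∘ fs) (f≡0 ∘ fs))

indicator-fz : Fin (suc (suc m)) → Fin (suc (suc m))
indicator-fz fz     = fs fz
indicator-fz (fs _) = fz

no-full-length-sequence : 2 ≤ n → ¬ HasEProperty n (ℤ′ n) (One n) n
no-full-length-sequence {suc zero} (s≤s ())
no-full-length-sequence {suc (suc m)} _ has with has indicator-fz
... | f , f↑ , a , _ , a≢0 , _ , n∣Σae , _ =
  ℕ.<⇒≱ (Fin.toℕ<n (a fz)) (ℕ.∣⇒≤ ⦃ ℕ.≢-nonZero (a≢0 fz) ⦄ (subst (_ ℕ.∣_) Σae≡a₀ n∣Σae))
  where
  ae : Fin (suc (suc m)) → ℕ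
  ae i = toℕ (a i) * toℕ (indicator-fz (f i))

  ae≡0 : ∀ i → ae (fs i) ≡ 0
  ae≡0 i with f (fs i) | strictlyIncreasing-suc≢fz f↑ i
  ... | fz   | fᵢ₊₁≢0 = contradiction refl fᵢ₊₁≢0
  ... | fs _ | _      = ℕ.*-zeroʳ (toℕ (a (fs i)))

  Σae≡a₀ : Σ[< suc (suc m) ] ae ≡ toℕ (a fz)
  Σae≡a₀ = begin
    ae fz + Σ[< suc m ] (ae ∘ fs)
      ≡⟨ cong₂ _+_ (cong (λ j → toℕ (a fz) * toℕ (indicator-fz j)) (strictlyIncreasing-fz f f↑))
                   (Σ-zero (ae ∘ fs) ae≡0) ⟩
    toℕ (a fz) * 1 + 0 ≡⟨ trans (ℕ.+-identityʳ _) (ℕ.*-identityʳ _) ⟩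
    toℕ (a fz)         ∎
    where open ≡-Reasoning

E-is-n+1 : {A B : Fin n → Set} → HasEProperty n A B (suc n) → ¬ HasEProperty n A B n → E-is n A B (n + 1)
E-is-n+1 {n} {A} {B} upper not-n = ℕ.m≤n+m 1 n , subst (HasEProperty n A B) (ℕ.+-comm 1 n) upper , below
  where
  below : ∀ k → 1 ≤ k → k < n + 1 → ¬ HasEProperty n A B k
  below k _ k<n+1 with ℕ.m≤n⇒m<n∨m≡n (ℕ.m<1+n⇒m≤n (subst (k <_) (ℕ.+-comm n 1) k<n+1))
  ... | inj₁ k<n  = no-shorter-sequence {A = A} {B} k<n
  ... | inj₂ refl = not-n

theorem7 : (n : ℕ) → 2 ≤ n → n ≢ 3 → E-is n (ℤ′ n) (One n) (n + 1)
theorem7 n 2≤n n≢3 = E-is-n+1 {A = ℤ′ n} {One n} (upper n 2≤n n≢3) (no-full-length-sequence 2≤n)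
  where
  upper : ∀ n → 2 ≤ n → n ≢ 3 → HasEProperty n (ℤ′ n) (One n) (suc n)
  upper 1                         (s≤s ()) _
  upper 2                         _        _   = upper-bound-2
  upper 3                         _        3≢3 = contradiction refl 3≢3
  upper (suc (suc (suc (suc m)))) _        _   = upper-bound (s≤s (s≤s (s≤s (s≤s z≤n))))
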